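{- Let $\pi$ be a full permutation of $[n]$ with $n>1$. Then every bracketing process applied to $\pi$ terminates in a single meld whose set of entries is $[n]$, and this meld (the top-level bracketing of $\pi$) has the form $(m_1,m_2)$ or $[m_1,m_2]$ for two melds $m_1,m_2$.
   Context: $[n]=\{1,\dots,n\}$; permutations $\pi=a_1\cdots a_n$ are in one-line notation. The permutation matrix of $\pi$ has a $1$ in row $n+1-a_j$, column $j$. Bootstrap percolation: a cell is mutable if it contains $0$ and at least two orthogonal neighbours contain $1$; mutable cells are changed to $1$ one at a time until none remain (the final result is independent of the order). $\pi$ is full if the final configuration is the all-ones matrix. Melds: each entry $a_j$ (occupying position $j$) is a meld with entry set $\{a_j\}$. If $m_1,m_2$ are melds occupying adjacent intervals of positions, $m_1$ immediately to the left of $m_2$, with entry sets $E_1,E_2$ such that $E_1\cup E_2$ is a set of consecutive integers, then they are mergeable, and their merger is the meld $(m_1,m_2)$ if $\max E_1+1=\min E_2$, and $[m_1,m_2]$ if $\min E_1=\max E_2+1$; its entry set is $E_1\cup E_2$. A bracketing process starts with the sequence of singleton melds $a_1,\dots,a_n$ and repeatedly replaces some adjacent mergeable pair by its merger (in some specified order) until no adjacent pair is mergeable. -}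

module Defs where

open import Data.Nat using (ℕ; zero; suc; _≤_; _∸_; _≤ᵇ_; _≡ᵇ_)
open import Data.Bool using (Bool; true; false; _∧_; if_then_else_)
open import Data.List using (List; []; _∷_; _++_; map; applyUpTo)
open import Data.Nat.ListAction using (sum)
open import Data.List.Membership.Propositional using (_∈_)
open import Data.List.Relation.Binary.Permutation.Propositional using (_↭_)
open import Data.Product using (Σ; _×_; _,_; ∃; ∃₂)
open import Relation.Binary.PropositionalEquality using (_≡_)
open import Relation.Nullary using (¬_)
open import Relation.Binary.Construct.Closure.ReflexiveTransitive using (Star)

[1‥_] : ℕ → List ℕ
[1‥ n ] = applyUpTo suc n

IsPermutation : ℕ → List ℕ → Set
IsPermutation n π = π ↭ [1‥ n ]

-- entry π j = a_j for 1 ≤ j ≤ length π (positions are 1-indexed);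
-- value 0 outside that range (never used inside the grid).
entry : List ℕ → ℕ → ℕ
entry []       _             = 0
entry (a ∷ as) zero          = 0
entry (a ∷ as) (suc zero)    = a
entry (a ∷ as) (suc (suc j)) = entry as (suc j)

-- Bootstrap percolation on the n × n grid.  Cells are (row r, column c)
-- with 1 ≤ r, c ≤ n; a configuration assigns a bit to every cell
-- (values outside the grid are irrelevant).

Config : Set
Config = ℕ → ℕ → Bool

inGrid : ℕ → ℕ → ℕ → Bool
inGrid n r c = (1 ≤ᵇ r) ∧ (r ≤ᵇ n) ∧ (1 ≤ᵇ c) ∧ (c ≤ᵇ n)

permMatrix : ℕ → List ℕ → Config
permMatrix n π r c = inGrid n r c ∧ (r ≡ᵇ (suc n ∸ entry π c))

val : ℕ → Config → ℕ → ℕ → Bool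
val n C r c = inGrid n r c ∧ C r c

onesAround : ℕ → Config → ℕ → ℕ → ℕ
onesAround n C r c =
  sum (map (λ b → if b then 1 else 0)
    (val n C (suc r) c ∷ val n C (r ∸ 1) c ∷ val n C r (suc c) ∷ val n C r (c ∸ 1) ∷ []))

Mutable : ℕ → Config → ℕ → ℕ → Set
Mutable n C r c = (inGrid n r c ≡ true) × (C r c ≡ false) × (2 ≤ onesAround n C r c)

PercStep : ℕ → Config → Config → Set
PercStep n C C′ = ∃₂ λ r c → Mutable n C r c ×
  (∀ r′ c′ → C′ r′ c′ ≡ (if (r′ ≡ᵇ r) ∧ (c′ ≡ᵇ c) then true else C r′ c′))

-- π is full: percolation from its permutation matrix reaches the
-- all-ones matrix (the final configuration is order independent).
Full : ℕ → List ℕ → Set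
Full n π = ∃ λ C → Star (PercStep n) (permMatrix n π) C ×
  (∀ r c → inGrid n r c ≡ true → C r c ≡ true)

data Meld : Set where
  leaf  : ℕ → Meld
  paren : Meld → Meld → Meld
  brack : Meld → Meld → Meld

entries : Meld → List ℕ
entries (leaf a)      = a ∷ []
entries (paren m₁ m₂) = entries m₁ ++ entries m₂
entries (brack m₁ m₂) = entries m₁ ++ entries m₂

Consecutive : List ℕ → Set
Consecutive E = ∀ {x y k} → x ∈ E → y ∈ E → x ≤ k → k ≤ y → k ∈ E

IsMax : List ℕ → ℕ → Set
IsMax E m = m ∈ E × (∀ {x} → x ∈ E → x ≤ m)

IsMin : List ℕ → ℕ → Set
IsMin E m = m ∈ E × (∀ {x} → x ∈ E → m ≤ x)

Mergeable : Meld → Meld → Set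
Mergeable m₁ m₂ = Consecutive (entries m₁ ++ entries m₂)

data Merger (m₁ m₂ : Meld) : Meld → Set where
  mk-paren : Mergeable m₁ m₂ →
             (∃₂ λ a b → IsMax (entries m₁) a × IsMin (entries m₂) b × suc a ≡ b) →
             Merger m₁ m₂ (paren m₁ m₂)
  mk-brack : Mergeable m₁ m₂ →
             (∃₂ λ a b → IsMin (entries m₁) a × IsMax (entries m₂) b × a ≡ suc b) →
             Merger m₁ m₂ (brack m₁ m₂)

data BracketStep : List Meld → List Meld → Set where
  here  : ∀ {m₁ m₂ m ms} → Merger m₁ m₂ m → BracketStep (m₁ ∷ m₂ ∷ ms) (m ∷ ms)
  there : ∀ {x ms ms′} → BracketStep ms ms′ → BracketStep (x ∷ ms) (x ∷ ms′)

NoAdjacentMergeable : List Meld → Set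
NoAdjacentMergeable L = ∀ xs m₁ m₂ ys → L ≡ xs ++ (m₁ ∷ m₂ ∷ ys) → ¬ Mergeable m₁ m₂

initialMelds : List ℕ → List Meld
initialMelds π = map leaf π

-- After any bracketing process every meld still has a consecutive set of entries, so a meld m
-- occupies the rectangle (positions of m) × (entries of m) of the permutation matrix, and these
-- rectangles contain all its ones.  If no adjacent pair is mergeable, their union is closed under
-- percolation: of the four neighbours of a cell outside it, two vertical ones would put the cell
-- inside an interval, a vertical and a horizontal one would make two adjacent melds mergeable, and
-- the two horizontal ones would put one value into two different melds.  So percolation never
-- leaves the union; for a full permutation the union is therefore the whole grid, which is only
-- possible for a single meld, and as n > 1 this meld is a merger.
module Submission where

open import Defs
open import Data.Bool using (Bool; true; false; _∧_; if_then_else_)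
open import Data.Empty using (⊥-elim)
open import Data.List using (List; []; _∷_; _++_; map; length; concatMap)
open import Data.List.Properties using (length-++; ++-assoc; ++-identityʳ; length-applyUpTo)
open import Data.List.Membership.Propositional using (_∈_)
open import Data.List.Membership.Propositional.Properties
  using (∈-++⁺ˡ; ∈-++⁺ʳ; ∈-++⁻; ∈-applyUpTo⁺; ∈-applyUpTo⁻)
open import Data.List.Relation.Unary.Any using (here; there)
open import Data.List.Relation.Unary.Any.Properties using (++-comm)
open import Data.List.Relation.Unary.All as All using (All; []; _∷_)
open import Data.List.Relation.Unary.AllPairs using (_∷_)
open import Data.List.Relation.Unary.Unique.Propositional using (Unique)
open import Data.List.Relation.Unary.Unique.Propositional.Properties using (applyUpTo⁺₁)
open import Data.List.Relation.Binary.Disjoint.Propositional using (Disjoint)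
open import Data.List.Relation.Binary.Permutation.Propositional using (↭⇒↭ₛ; ↭-sym)
open import Data.List.Relation.Binary.Permutation.Propositional.Properties
  using (∈-resp-↭; ↭-length)
open import Data.List.Relation.Binary.Permutation.Setoid.Properties using (Unique-resp-↭)
open import Data.Nat
  using (ℕ; zero; suc; _+_; _∸_; _<_; _≤_; z≤n; s≤s; _≤ᵇ_; _≡ᵇ_; _≤?_)
open import Data.Nat.Properties
open import Data.Nat.ListAction using (sum)
open import Data.Product using (_×_; _,_; ∃; ∃₂; proj₁; proj₂)
open import Data.Sum using (_⊎_; inj₁; inj₂)
open import Data.Bool.Properties using (T-≡)
open import Function using (_∘_; id; Equivalence)
open import Relation.Binary.PropositionalEquality
open import Relation.Binary.Construct.Closure.ReflexiveTransitive as Star using (Star)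
open import Relation.Nullary using (yes; no)

Star-preserves : ∀ {A : Set} {R : A → A → Set} (P : A → Set) →
  (∀ {x y} → R x y → P x → P y) → ∀ {x y} → Star R x y → P x → P y
Star-preserves P step = Star.fold (λ x y → P x → P y) (λ r k → k ∘ step r) id

∧≡true⇒ : ∀ {a b} → a ∧ b ≡ true → a ≡ true × b ≡ true
∧≡true⇒ {true} e = refl , e

≤ᵇ≡true⇒≤ : ∀ {m n} → (m ≤ᵇ n) ≡ true → m ≤ n
≤ᵇ≡true⇒≤ {m} {n} e = ≤ᵇ⇒≤ m n (Equivalence.from T-≡ e)

≤⇒≤ᵇ≡true : ∀ {m n} → m ≤ n → (m ≤ᵇ n) ≡ true
≤⇒≤ᵇ≡true m≤n = Equivalence.to T-≡ (≤⇒≤ᵇ m≤n)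

≡ᵇ≡true⇒≡ : ∀ {m n} → (m ≡ᵇ n) ≡ true → m ≡ n
≡ᵇ≡true⇒≡ {m} {n} e = ≡ᵇ⇒≡ m n (Equivalence.from T-≡ e)

inGrid⇒ : ∀ {n r c} → inGrid n r c ≡ true → 1 ≤ r × r ≤ n × 1 ≤ c × c ≤ n
inGrid⇒ e with ∧≡true⇒ e
... | e₁ , e′ with ∧≡true⇒ e′
...   | e₂ , e″ with ∧≡true⇒ e″
...     | e₃ , e₄ =
  ≤ᵇ≡true⇒≤ e₁ , ≤ᵇ≡true⇒≤ e₂ , ≤ᵇ≡true⇒≤ e₃ , ≤ᵇ≡true⇒≤ e₄

inGrid⁺ : ∀ {n r c} → 1 ≤ r → r ≤ n → 1 ≤ c → c ≤ n → inGrid n r c ≡ true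
inGrid⁺ 1≤r r≤n 1≤c c≤n
  rewrite ≤⇒≤ᵇ≡true 1≤r | ≤⇒≤ᵇ≡true r≤n | ≤⇒≤ᵇ≡true 1≤c | ≤⇒≤ᵇ≡true c≤n = refl

∈[1‥]⇒ : ∀ {n k} → k ∈ [1‥ n ] → 1 ≤ k × k ≤ n
∈[1‥]⇒ p with ∈-applyUpTo⁻ suc p
... | _ , i<n , refl = s≤s z≤n , i<n

∈[1‥]⁺ : ∀ {n k} → 1 ≤ k → k ≤ n → k ∈ [1‥ n ]
∈[1‥]⁺ {k = suc k} _ k<n = ∈-applyUpTo⁺ suc k<n

IsPermutation⇒∈⇔range : ∀ {n π} → IsPermutation n π →
  ∀ k → (k ∈ π → 1 ≤ k × k ≤ n) × (1 ≤ k × k ≤ n → k ∈ π)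
IsPermutation⇒∈⇔range perm k =
    (λ k∈π → ∈[1‥]⇒ (∈-resp-↭ perm k∈π))
  , (λ (1≤k , k≤n) → ∈-resp-↭ (↭-sym perm) (∈[1‥]⁺ 1≤k k≤n))

IsPermutation⇒length : ∀ {n π} → IsPermutation n π → length π ≡ n
IsPermutation⇒length {n} perm = trans (↭-length perm) (length-applyUpTo suc n)

IsPermutation⇒Unique : ∀ {n π} → IsPermutation n π → Unique π
IsPermutation⇒Unique {n} perm =
  Unique-resp-↭ (setoid ℕ) (↭⇒↭ₛ (↭-sym perm))
    (applyUpTo⁺₁ suc n (λ i<j _ → <⇒≢ i<j ∘ suc-injective))

Unique-++⇒Disjoint : ∀ {A : Set} (xs : List A) {ys} → Unique (xs ++ ys) → Disjoint xs ys
Unique-++⇒Disjoint (x ∷ xs) (x∉ ∷ _)   (here refl , v∈ys)  = All.lookup x∉ (∈-++⁺ʳ xs v∈ys) refl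
Unique-++⇒Disjoint (x ∷ xs) (_ ∷ uniq) (there v∈xs , v∈ys) =
  Unique-++⇒Disjoint xs uniq (v∈xs , v∈ys)

Unique-++⁻ʳ : ∀ {A : Set} (xs : List A) {ys} → Unique (xs ++ ys) → Unique ys
Unique-++⁻ʳ []       uniq       = uniq
Unique-++⁻ʳ (x ∷ xs) (_ ∷ uniq) = Unique-++⁻ʳ xs uniq

Consecutive-singleton : ∀ a → Consecutive (a ∷ [])
Consecutive-singleton a (here refl) (here refl) a≤k k≤a = here (≤-antisym k≤a a≤k)

Consecutive-++ : ∀ {A B x} → Consecutive A → Consecutive B → x ∈ A → suc x ∈ B →
  Consecutive (A ++ B)
Consecutive-++ {A} {x = x} consA consB x∈A 1+x∈B {k = k} p∈ q∈ p≤k k≤q with k ≤? x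
... | yes k≤x with ∈-++⁻ A p∈
...   | inj₁ p∈A = ∈-++⁺ˡ (consA p∈A x∈A p≤k k≤x)
...   | inj₂ p∈B = ∈-++⁺ʳ A (consB p∈B 1+x∈B p≤k (m≤n⇒m≤1+n k≤x))
Consecutive-++ {A} consA consB x∈A 1+x∈B p∈ q∈ p≤k k≤q | no k≰x with ∈-++⁻ A q∈
...   | inj₁ q∈A = ∈-++⁺ˡ (consA x∈A q∈A (<⇒≤ (≰⇒> k≰x)) k≤q)
...   | inj₂ q∈B = ∈-++⁺ʳ A (consB 1+x∈B q∈B (≰⇒> k≰x) k≤q)

Consecutive-++-comm : ∀ A {B} → Consecutive (A ++ B) → Consecutive (B ++ A)
Consecutive-++-comm A {B} cons p∈ q∈ p≤k k≤q =
  ++-comm A B (cons (++-comm B A p∈) (++-comm B A q∈) p≤k k≤q)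

Consecutive-++-adjacent : ∀ {A B a b} → Consecutive A → Consecutive B → a ∈ A → b ∈ B →
  suc a ≡ b ⊎ suc b ≡ a → Consecutive (A ++ B)
Consecutive-++-adjacent consA consB a∈A b∈B (inj₁ refl) = Consecutive-++ consA consB a∈A b∈B
Consecutive-++-adjacent {B = B} consA consB a∈A b∈B (inj₂ refl) =
  Consecutive-++-comm B (Consecutive-++ consB consA b∈B a∈A)

entriesOf : List Meld → List ℕ
entriesOf = concatMap entries

ConsecutiveMeld : Meld → Set
ConsecutiveMeld = Consecutive ∘ entries

entries-nonempty : ∀ m → ∃₂ λ a as → entries m ≡ a ∷ as
entries-nonempty (leaf a) = a , [] , refl
entries-nonempty (paren m₁ m₂) with entries-nonempty m₁
... | a , as , e = a , as ++ entries m₂ , cong (_++ entries m₂) e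
entries-nonempty (brack m₁ m₂) with entries-nonempty m₁
... | a , as , e = a , as ++ entries m₂ , cong (_++ entries m₂) e

entriesOf-initialMelds : ∀ π → entriesOf (initialMelds π) ≡ π
entriesOf-initialMelds []      = refl
entriesOf-initialMelds (a ∷ π) = cong (a ∷_) (entriesOf-initialMelds π)

Merger⇒ConsecutiveMeld : ∀ {m₁ m₂ m} → Merger m₁ m₂ m → ConsecutiveMeld m
Merger⇒ConsecutiveMeld (mk-paren mergeable _) = mergeable
Merger⇒ConsecutiveMeld (mk-brack mergeable _) = mergeable

BracketStep-entriesOf : ∀ {L L′} → BracketStep L L′ → entriesOf L′ ≡ entriesOf L
BracketStep-entriesOf (here {m₁} {m₂} {ms = ms} (mk-paren _ _)) =
  ++-assoc (entries m₁) (entries m₂) (entriesOf ms)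
BracketStep-entriesOf (here {m₁} {m₂} {ms = ms} (mk-brack _ _)) =
  ++-assoc (entries m₁) (entries m₂) (entriesOf ms)
BracketStep-entriesOf (there {x} step) = cong (entries x ++_) (BracketStep-entriesOf step)

BracketStep-Consecutive : ∀ {L L′} → BracketStep L L′ →
  All ConsecutiveMeld L → All ConsecutiveMeld L′
BracketStep-Consecutive (here merger) (_ ∷ _ ∷ cons) = Merger⇒ConsecutiveMeld merger ∷ cons
BracketStep-Consecutive (there step) (c ∷ cons) = c ∷ BracketStep-Consecutive step cons

bracketing-invariant : ∀ {π L} → Star BracketStep (initialMelds π) L →
  entriesOf L ≡ π × All ConsecutiveMeld L
bracketing-invariant {π} steps = Star-preserves (λ L → entriesOf L ≡ π × All ConsecutiveMeld L)
  (λ step (e , cons) → trans (BracketStep-entriesOf step) e , BracketStep-Consecutive step cons)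
  steps (entriesOf-initialMelds π , initial π)
  where
    initial : ∀ π → All ConsecutiveMeld (initialMelds π)
    initial []      = []
    initial (a ∷ π) = Consecutive-singleton a ∷ initial π

-- Positions are counted from 1, as in `entry`; beyond the last position the block is [].
blockOf : List Meld → ℕ → List ℕ
blockOf []      c = []
blockOf (m ∷ L) c =
  if c ≤ᵇ length (entries m) then entries m else blockOf L (c ∸ length (entries m))

-- `beyond` is indexed by suc d + ℓ, not ℓ + suc d, so that its successor is again of that form.
data Position (ℓ : ℕ) : ℕ → Set where
  inside : ∀ {c} → c ≤ ℓ → Position ℓ c
  beyond : ∀ d → Position ℓ (suc d + ℓ)

position : ∀ ℓ c → Position ℓ c
position ℓ c with c ≤? ℓ
... | yes c≤ℓ = inside c≤ℓ
... | no c≰ℓ with m≤n⇒∃[o]m+o≡n (≰⇒> c≰ℓ)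
...   | d , refl = subst (Position ℓ) (cong suc (+-comm d ℓ)) (beyond d)

blockOf-inside : ∀ m L {c} → c ≤ length (entries m) → blockOf (m ∷ L) c ≡ entries m
blockOf-inside m L c≤ℓ rewrite ≤⇒≤ᵇ≡true c≤ℓ = refl

blockOf-beyond : ∀ m L d → blockOf (m ∷ L) (suc d + length (entries m)) ≡ blockOf L (suc d)
blockOf-beyond m L d with suc d + length (entries m) ≤ᵇ length (entries m) in eq
... | true  = ⊥-elim (<⇒≱ (≤ᵇ≡true⇒≤ eq) (m≤n+m (length (entries m)) d))
... | false = cong (blockOf L) (m+n∸n≡m (suc d) (length (entries m)))

blockOf-inside-suc : ∀ m L {c} → suc c ≤ length (entries m) →
  blockOf (m ∷ L) c ≡ blockOf (m ∷ L) (suc c)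
blockOf-inside-suc m L 1+c≤ℓ =
  trans (blockOf-inside m L (≤-trans (n≤1+n _) 1+c≤ℓ)) (sym (blockOf-inside m L 1+c≤ℓ))

blockOf-first : ∀ m L → blockOf (m ∷ L) 1 ≡ entries m
blockOf-first m L with entries-nonempty m
... | _ , _ , e = blockOf-inside m L (subst (λ E → 1 ≤ length E) (sym e) (s≤s z≤n))

blockOf-⊆ : ∀ L c {v} → v ∈ blockOf L c → v ∈ entriesOf L
blockOf-⊆ (m ∷ L) c v∈ with c ≤ᵇ length (entries m)
... | true  = ∈-++⁺ˡ v∈
... | false = ∈-++⁺ʳ (entries m) (blockOf-⊆ L _ v∈)

blockOf-Consecutive : ∀ {L} → All ConsecutiveMeld L → ∀ c → Consecutive (blockOf L c)
blockOf-Consecutive []                c ()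
blockOf-Consecutive {m ∷ L} (cm ∷ cons) c with c ≤ᵇ length (entries m)
... | true  = cm
... | false = blockOf-Consecutive cons _

entry-++ˡ : ∀ E R {c} → 1 ≤ c → c ≤ length E → entry (E ++ R) c ∈ E
entry-++ˡ (a ∷ E) R {suc zero}    _ _         = here refl
entry-++ˡ (a ∷ E) R {suc (suc c)} _ (s≤s c≤ℓ) = there (entry-++ˡ E R (s≤s z≤n) c≤ℓ)

entry-++ʳ : ∀ E R d → entry (E ++ R) (suc (length E + d)) ≡ entry R (suc d)
entry-++ʳ []      R d = refl
entry-++ʳ (a ∷ E) R d = entry-++ʳ E R d

entry-∈-blockOf : ∀ L {c} → 1 ≤ c → c ≤ length (entriesOf L) →
  entry (entriesOf L) c ∈ blockOf L c
entry-∈-blockOf []      (s≤s _) ()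
entry-∈-blockOf (m ∷ L) {c} 1≤c c≤len with position (length (entries m)) c
... | inside c≤ℓ =
  subst (entry (entriesOf (m ∷ L)) c ∈_) (sym (blockOf-inside m L c≤ℓ))
    (entry-++ˡ (entries m) (entriesOf L) 1≤c c≤ℓ)
... | beyond d =
  subst₂ _∈_ (sym entry-beyond) (sym (blockOf-beyond m L d)) (entry-∈-blockOf L (s≤s z≤n) d<len)
  where
    ℓ = length (entries m)
    entry-beyond : entry (entriesOf (m ∷ L)) (suc d + ℓ) ≡ entry (entriesOf L) (suc d)
    entry-beyond =
      trans (cong (entry (entriesOf (m ∷ L)) ∘ suc) (+-comm d ℓ)) (entry-++ʳ (entries m) (entriesOf L) d)
    d<len : suc d ≤ length (entriesOf L)
    d<len = +-cancelʳ-≤ ℓ (suc d) _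
      (subst (suc d + ℓ ≤_) (trans (length-++ (entries m)) (+-comm ℓ _)) c≤len)

AdjacentBlocks : List Meld → ℕ → Set
AdjacentBlocks L c = ∃₂ λ xs ys → ∃₂ λ m₁ m₂ →
  L ≡ xs ++ m₁ ∷ m₂ ∷ ys × blockOf L c ≡ entries m₁ × blockOf L (suc c) ≡ entries m₂

blockOf-suc : ∀ L c {b} → b ∈ blockOf L (suc c) →
  blockOf L c ≡ blockOf L (suc c) ⊎ AdjacentBlocks L c
blockOf-suc (m ∷ L) c {b} b∈ with position (length (entries m)) (suc c)
... | inside 1+c≤ℓ = inj₁ (blockOf-inside-suc m L 1+c≤ℓ)
... | beyond zero = inj₂ (next L (subst (b ∈_) (blockOf-beyond m L 0) b∈))
  where
    next : ∀ L → b ∈ blockOf L 1 → AdjacentBlocks (m ∷ L) (length (entries m))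
    next (m₂ ∷ ys) _ =
      [] , ys , m , m₂ , refl , blockOf-inside m (m₂ ∷ ys) ≤-refl ,
      trans (blockOf-beyond m (m₂ ∷ ys) 0) (blockOf-first m₂ ys)
... | beyond (suc d) with blockOf-suc L (suc d) (subst (b ∈_) (blockOf-beyond m L (suc d)) b∈)
...   | inj₁ eq = inj₁ (trans (blockOf-beyond m L d) (trans eq (sym (blockOf-beyond m L (suc d)))))
...   | inj₂ (xs , ys , m₁ , m₂ , e , B₁ , B₂) =
  inj₂ ( m ∷ xs , ys , m₁ , m₂ , cong (m ∷_) e
       , trans (blockOf-beyond m L d) B₁ , trans (blockOf-beyond m L (suc d)) B₂)

blockOf-between : ∀ L c {v} → Unique (entriesOf L) →
  v ∈ blockOf L c → v ∈ blockOf L (suc (suc c)) → v ∈ blockOf L (suc c)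
blockOf-between (m ∷ L) c {v} uniq v∈c v∈2+c with position (length (entries m)) (suc c)
... | inside 1+c≤ℓ = subst (v ∈_) (blockOf-inside-suc m L 1+c≤ℓ) v∈c
... | beyond zero = ⊥-elim (Unique-++⇒Disjoint (entries m) uniq
  ( subst (v ∈_) (blockOf-inside m L ≤-refl) v∈c
  , blockOf-⊆ L 2 (subst (v ∈_) (blockOf-beyond m L 1) v∈2+c)))
... | beyond (suc d) = subst (v ∈_) (sym (blockOf-beyond m L (suc d)))
  (blockOf-between L (suc d) (Unique-++⁻ʳ (entries m) uniq)
    (subst (v ∈_) (blockOf-beyond m L d) v∈c)
    (subst (v ∈_) (blockOf-beyond m L (suc (suc d))) v∈2+c))

adjacent-values⇒same-block : ∀ {L} → All ConsecutiveMeld L → NoAdjacentMergeable L →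
  ∀ c {a b} → a ∈ blockOf L c → b ∈ blockOf L (suc c) → suc a ≡ b ⊎ suc b ≡ a →
  blockOf L c ≡ blockOf L (suc c)
adjacent-values⇒same-block {L} cons stuck c {a} {b} a∈ b∈ adjacent with blockOf-suc L c b∈
... | inj₁ same = same
... | inj₂ (xs , ys , m₁ , m₂ , e , B₁ , B₂) = ⊥-elim (stuck xs m₁ m₂ ys e
  (Consecutive-++-adjacent
    (subst Consecutive B₁ (blockOf-Consecutive cons c))
    (subst Consecutive B₂ (blockOf-Consecutive cons (suc c)))
    (subst (a ∈_) B₁ a∈) (subst (b ∈_) B₂ b∈) adjacent))

Cells : Set₁
Cells = ℕ → ℕ → Set

OnesWithin : ℕ → Config → Cells → Set
OnesWithin n C S = ∀ r c → val n C r c ≡ true → S r c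

PercolationClosed : ℕ → Cells → Set
PercolationClosed n S = ∀ C → OnesWithin n C S → ∀ r c → Mutable n C r c → S r c

PercStep-OnesWithin : ∀ {n S C C′} → PercolationClosed n S → PercStep n C C′ →
  OnesWithin n C S → OnesWithin n C′ S
PercStep-OnesWithin {C = C} closed (r₀ , c₀ , mutable , update) ones r c val′
  with (r ≡ᵇ r₀) ∧ (c ≡ᵇ c₀) in updated
... | true with ∧≡true⇒ updated
...   | r≡ , c≡ rewrite ≡ᵇ≡true⇒≡ {r} r≡ | ≡ᵇ≡true⇒≡ {c} c≡ = closed C ones r₀ c₀ mutable
PercStep-OnesWithin {n} {C = C} {C′} closed (r₀ , c₀ , mutable , update) ones r c val′
    | false = ones r c (subst (λ x → inGrid n r c ∧ x ≡ true) unchanged val′)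
  where
    unchanged : C′ r c ≡ C r c
    unchanged = trans (update r c) (cong (λ b → if b then true else C r c) updated)

Full⇒covers-grid : ∀ {n π S} → PercolationClosed n S → OnesWithin n (permMatrix n π) S →
  Full n π → ∀ r c → inGrid n r c ≡ true → S r c
Full⇒covers-grid {n} {S = S} closed initial (C , steps , allOnes) r c onGrid =
  Star-preserves (λ C → OnesWithin n C S) (PercStep-OnesWithin closed) steps initial r c
    (subst₂ (λ g x → g ∧ x ≡ true) (sym onGrid) (sym (allOnes r c onGrid)) refl)

data TwoOfFour (b₁ b₂ b₃ b₄ : Bool) : Set where
  pair₁₂ : b₁ ≡ true → b₂ ≡ true → TwoOfFour b₁ b₂ b₃ b₄
  pair₁₃ : b₁ ≡ true → b₃ ≡ true → TwoOfFour b₁ b₂ b₃ b₄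
  pair₁₄ : b₁ ≡ true → b₄ ≡ true → TwoOfFour b₁ b₂ b₃ b₄
  pair₂₃ : b₂ ≡ true → b₃ ≡ true → TwoOfFour b₁ b₂ b₃ b₄
  pair₂₄ : b₂ ≡ true → b₄ ≡ true → TwoOfFour b₁ b₂ b₃ b₄
  pair₃₄ : b₃ ≡ true → b₄ ≡ true → TwoOfFour b₁ b₂ b₃ b₄

twoOfFour : ∀ b₁ b₂ b₃ b₄ →
  2 ≤ sum (map (λ b → if b then 1 else 0) (b₁ ∷ b₂ ∷ b₃ ∷ b₄ ∷ [])) → TwoOfFour b₁ b₂ b₃ b₄
twoOfFour true  true  _     _     _ = pair₁₂ refl refl
twoOfFour true  false true  _     _ = pair₁₃ refl refl
twoOfFour true  false false true  _ = pair₁₄ refl refl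
twoOfFour false true  true  _     _ = pair₂₃ refl refl
twoOfFour false true  false true  _ = pair₂₄ refl refl
twoOfFour false false true  true  _ = pair₃₄ refl refl
twoOfFour true  false false false (s≤s ())
twoOfFour false true  false false (s≤s ())
twoOfFour false false true  false (s≤s ())
twoOfFour false false false true  (s≤s ())
twoOfFour false false false false ()

-- Row r holds the value n + 1 − r, so InBlocks n L is the union over the melds m ∈ L
-- of the rectangles (positions of m) × (entries of m).
InBlocks : ℕ → List Meld → Cells
InBlocks n L r c = (suc n ∸ r) ∈ blockOf L c

InBlocks-PercolationClosed : ∀ {n} L → Unique (entriesOf L) → All ConsecutiveMeld L →
  NoAdjacentMergeable L → PercolationClosed n (InBlocks n L)
InBlocks-PercolationClosed _ _ _ _ C ones zero c (() , _)
InBlocks-PercolationClosed {n} _ _ _ _ C ones (suc r) zero (onGrid , _)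
  with inGrid⇒ {n} {suc r} {zero} onGrid
... | _ , _ , () , _
InBlocks-PercolationClosed {n} L uniq cons stuck C ones (suc r) (suc c) (onGrid , _ , two)
  with inGrid⇒ {n} {suc r} {suc c} onGrid
... | _ , r<n , _ = absorb (twoOfFour _ _ _ _ two)
  where
    below≡ : suc (n ∸ suc r) ≡ n ∸ r
    below≡ = sym (+-∸-assoc 1 r<n)
    above≡ : suc n ∸ r ≡ suc (n ∸ r)
    above≡ = +-∸-assoc 1 (≤-trans (n≤1+n r) r<n)
    same-block = adjacent-values⇒same-block cons stuck
    absorb : TwoOfFour (val n C (suc (suc r)) (suc c)) (val n C r (suc c))
                       (val n C (suc r) (suc (suc c))) (val n C (suc r) c) →
             (n ∸ r) ∈ blockOf L (suc c)
    absorb (pair₁₂ below above) = blockOf-Consecutive cons (suc c) (ones _ _ below) (ones _ _ above)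
      (subst (n ∸ suc r ≤_) below≡ (n≤1+n _)) (subst (n ∸ r ≤_) (sym above≡) (n≤1+n _))
    absorb (pair₁₃ below right) = subst (n ∸ r ∈_)
      (sym (same-block (suc c) (ones _ _ below) (ones _ _ right) (inj₁ below≡))) (ones _ _ right)
    absorb (pair₁₄ below left) = subst (n ∸ r ∈_)
      (same-block c (ones _ _ left) (ones _ _ below) (inj₂ below≡)) (ones _ _ left)
    absorb (pair₂₃ above right) = subst (n ∸ r ∈_)
      (sym (same-block (suc c) (ones _ _ above) (ones _ _ right) (inj₂ (sym above≡)))) (ones _ _ right)
    absorb (pair₂₄ above left) = subst (n ∸ r ∈_)
      (same-block c (ones _ _ left) (ones _ _ above) (inj₁ (sym above≡))) (ones _ _ left)
    absorb (pair₃₄ right left) = blockOf-between L c uniq (ones _ _ left) (ones _ _ right)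

permMatrix-OnesWithin-InBlocks : ∀ {n} L → IsPermutation n (entriesOf L) →
  OnesWithin n (permMatrix n (entriesOf L)) (InBlocks n L)
permMatrix-OnesWithin-InBlocks {n} L perm r c ones with ∧≡true⇒ {inGrid n r c} ones
... | onGrid , one with ∧≡true⇒ {inGrid n r c} one | inGrid⇒ {n} {r} {c} onGrid
...   | _ , r≡ | _ , _ , 1≤c , c≤n rewrite ≡ᵇ≡true⇒≡ {r} r≡ =
  subst (_∈ blockOf L c) (sym (m∸[m∸n]≡n (m≤n⇒m≤1+n a≤n))) a∈
  where
    a∈ : entry (entriesOf L) c ∈ blockOf L c
    a∈ = entry-∈-blockOf L 1≤c (subst (c ≤_) (sym (IsPermutation⇒length perm)) c≤n)
    a≤n : entry (entriesOf L) c ≤ n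
    a≤n = proj₂ (proj₁ (IsPermutation⇒∈⇔range perm _) (blockOf-⊆ L c a∈))

Full⇒InBlocks-everywhere : ∀ {n} L → IsPermutation n (entriesOf L) → All ConsecutiveMeld L →
  NoAdjacentMergeable L → Full n (entriesOf L) →
  ∀ r c → inGrid n r c ≡ true → InBlocks n L r c
Full⇒InBlocks-everywhere L perm cons stuck = Full⇒covers-grid {π = entriesOf L}
  (InBlocks-PercolationClosed L (IsPermutation⇒Unique perm) cons stuck)
  (permMatrix-OnesWithin-InBlocks L perm)

row-of-value : ∀ {n v} → 1 ≤ v → v ≤ n → 1 ≤ suc n ∸ v × suc n ∸ v ≤ n
row-of-value {n} {suc v} _ v<n = subst (1 ≤_) (sym (+-∸-assoc 1 v<n)) (s≤s z≤n) , m∸n≤m n v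

Full⇒single-meld : ∀ {n L} → 1 ≤ n → IsPermutation n (entriesOf L) → All ConsecutiveMeld L →
  NoAdjacentMergeable L → Full n (entriesOf L) → ∃ λ m → L ≡ m ∷ []
Full⇒single-meld {L = []} 1≤n perm _ _ _ = ⊥-elim (<⇒≢ 1≤n (IsPermutation⇒length perm))
Full⇒single-meld {L = m ∷ []} _ _ _ _ _ = m , refl
Full⇒single-meld {n} {m₁ ∷ m₂ ∷ L} 1≤n perm cons stuck full with entries-nonempty m₂
... | v , _ , e =
  ⊥-elim (Unique-++⇒Disjoint (entries m₁) (IsPermutation⇒Unique perm) (v∈m₁ , ∈-++⁺ˡ v∈m₂))
  where
    v∈m₂ : v ∈ entries m₂
    v∈m₂ = subst (v ∈_) (sym e) (here refl)
    v-range : 1 ≤ v × v ≤ n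
    v-range = proj₁ (IsPermutation⇒∈⇔range perm v) (∈-++⁺ʳ (entries m₁) (∈-++⁺ˡ v∈m₂))
    row-range = row-of-value (proj₁ v-range) (proj₂ v-range)
    v∈m₁ : v ∈ entries m₁
    v∈m₁ = subst₂ _∈_ (m∸[m∸n]≡n (m≤n⇒m≤1+n (proj₂ v-range))) (blockOf-first m₁ (m₂ ∷ L))
      (Full⇒InBlocks-everywhere (m₁ ∷ m₂ ∷ L) perm cons stuck full (suc n ∸ v) 1
        (inGrid⁺ (proj₁ row-range) (proj₂ row-range) (s≤s z≤n) 1≤n))

lemma2p22 : (n : ℕ) (π : List ℕ) → IsPermutation n π → 1 < n → Full n π →
    ∀ (L : List Meld) → Star BracketStep (initialMelds π) L → NoAdjacentMergeable L →
    ∃₂ λ m₁ m₂ → (L ≡ paren m₁ m₂ ∷ [] × (∀ k → (k ∈ entries (paren m₁ m₂) → 1 ≤ k × k ≤ n) × (1 ≤ k × k ≤ n → k ∈ entries (paren m₁ m₂))))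
               ⊎ (L ≡ brack m₁ m₂ ∷ [] × (∀ k → (k ∈ entries (brack m₁ m₂) → 1 ≤ k × k ≤ n) × (1 ≤ k × k ≤ n → k ∈ entries (brack m₁ m₂))))
lemma2p22 n π perm 1<n full L steps stuck with bracketing-invariant steps
... | refl , cons with Full⇒single-meld (<⇒≤ 1<n) perm cons stuck full
...   | leaf a , refl = ⊥-elim (<⇒≢ 1<n (IsPermutation⇒length perm))
...   | paren m₁ m₂ , refl =
  m₁ , m₂ , inj₁ (refl , IsPermutation⇒∈⇔range (subst (IsPermutation n) (++-identityʳ _) perm))
...   | brack m₁ m₂ , refl =
  m₁ , m₂ , inj₂ (refl , IsPermutation⇒∈⇔range (subst (IsPermutation n) (++-identityʳ _) perm))
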